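{- Let $k\ge 2$ and let $A,b,C$ be as in the context. Let $D$ be an almost-feasible ordinal basis of $C$ with utility vector $u$. If $u_1\in\{k+1,\dots,k^2\}$ and $D$ contains at least one of the columns $2,\dots,k$, then there exists an index $i$ with $2\le i\le k$ such that, in the graph $G_D$ whose edges are those corresponding to the columns of $D$: (1) $m_i$ is incident to both a loop and one or more valid edges; (2) $m_2,\dots,m_{i-1}$ are incident to valid edges only, and $m_{i+1},\dots,m_k$ are incident to loops only; (3) $m_1$ is not incident to any edge.
   Context: Men $m_1,\dots,m_k$, women $w_1,\dots,w_k$; $v_i=m_i$, $v_{k+i}=w_i$, $n=2k$; all preferences strict and complete. Edges: loops $e_1,\dots,e_n$ ($e_i$ at $v_i$) and $k^2$ valid edges $(m,w)$; each agent prefers each valid edge containing it to its loop. Columns indexed by $[n+k^2]$: column $j\le n$ is loop $e_j$; for $i\in[k]$ columns $n+k(i-1)+1,\dots,n+ki$ are the edges $(m_i,w)$ in decreasing order of $m_i$'s preference. $A$: $a_{ij}=1$ iff $v_i\in e_j$; $b=(1,\dots,1)^T$. $C=(c_{ij})$: if $v_i\in e_j$ and $e_j$ is the $\ell$-th best of the $k+1$ edges containing $v_i$ (loop last), $c_{ij}=k+1-\ell$; if $e_j$ is a valid edge not containing $v_i$, $c_{ij}\in\{k+1,\dots,k^2\}$ assigned in decreasing order from left to right (smaller column index, larger value); if $e_j$ is a loop, $j\ne i$, $c_{ij}\in\{k^2+1,\dots,k^2+2k-1\}$ assigned in decreasing order from left to right. Ordinal basis: set $D$ of $n$ columns such that,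 with utility vector $u_i=\min_{j\in D}c_{ij}$, every column $h$ has some $i$ with $u_i\ge c_{ih}$. Feasible basis: $n$ linearly independent columns $B$ of $A$ with $A_B^{ -1}b\ge0$. An ordinal basis $D$ is almost-feasible if $1\notin D$ and there is a feasible basis $B$ with $1\in B$ and $|B\cap D|=n-1$. -}

module Defs where

open import Data.Nat using (ℕ; zero; suc; _+_; _*_; _∸_; _≤_; _<_)
open import Data.Bool using (Bool; true; false; if_then_else_; _∧_; not)
open import Data.Fin using (Fin; zero; suc; toℕ; splitAt; remQuot; combine; _↑ˡ_; _↑ʳ_; _≟_)
open import Data.Fin.Permutation using (Permutation′; _⟨$⟩ʳ_; _⟨$⟩ˡ_)
open import Data.Fin.Subset using (Subset; _∈_; _∉_; _∩_; ∣_∣; inside; outside)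
open import Data.Vec using ([]; _∷_)
open import Data.Maybe using (Maybe; just; nothing; fromMaybe)
open import Data.Sum using (_⊎_; inj₁; inj₂)
open import Data.Product using (_×_; _,_; Σ; ∃; ∃-syntax)
open import Relation.Nullary.Decidable using (⌊_⌋)
open import Relation.Binary.PropositionalEquality using (_≡_)
open import Data.Rational as ℚ using (ℚ; 0ℚ; 1ℚ)
import Data.Nat as Nat

-- Conventions (everything 0-indexed):
--  * vertices  : Fin (k + k);  man m_{i+1} = i ↑ˡ k,  woman w_{i+1} = k ↑ʳ i
--  * columns   : Fin ((k + k) + k * k);
--      column j < n (j = v ↑ˡ (k*k)) is the loop at vertex v,
--      column (k + k) ↑ʳ combine i r  (= n + k*i + r) is the valid edge
--      (m_{i+1}, r-th best woman of m_{i+1})   (r = 0 is the best)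
--  * preferences: men i is a permutation with  men i ⟨$⟩ʳ r = r-th best woman
--                 women w is a permutation with women w ⟨$⟩ʳ r = r-th best man
--    (all strict and complete; the loop is always worst).

record Prefs (k : ℕ) : Set where
  field
    men   : Fin k → Permutation′ k
    women : Fin k → Permutation′ k
open Prefs public

Vtx : ℕ → Set
Vtx k = Fin (k + k)

Col : ℕ → Set
Col k = Fin ((k + k) + k * k)

man : ∀ {k} → Fin k → Vtx k
man {k} i = i ↑ˡ k

woman : ∀ {k} → Fin k → Vtx k
woman {k} i = k ↑ʳ i

loopCol : ∀ {k} → Vtx k → Col k
loopCol {k} v = v ↑ˡ (k * k)

edgeCol : ∀ {k} → Fin k → Fin k → Col k
edgeCol {k} i r = (k + k) ↑ʳ combine i r

isLoop : ∀ {k} → Col k → Bool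
isLoop {k} j with splitAt (k + k) j
... | inj₁ _ = true
... | inj₂ _ = false

inc : ∀ {k} → Prefs k → Vtx k → Col k → Bool
inc {k} P v j with splitAt (k + k) j
... | inj₁ l = ⌊ v ≟ l ⌋
... | inj₂ e with remQuot k e
...   | (i , r) with splitAt k v
...     | inj₁ m = ⌊ m ≟ i ⌋
...     | inj₂ w = ⌊ w ≟ (men P i ⟨$⟩ʳ r) ⌋

countBelow : ∀ {m} → (Fin m → Bool) → ℕ → ℕ
countBelow {zero} p t = 0
countBelow {suc m} p zero = 0
countBelow {suc m} p (suc t) =
  (if p zero then 1 else 0) + countBelow (λ j → p (suc j)) t

cost : ∀ {k} → Prefs k → Vtx k → Col k → ℕ
cost {k} P v j with splitAt (k + k) j
... | inj₁ l = if ⌊ v ≟ l ⌋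
               then 0
               else (k * k + (k + k) ∸ 1)
                      ∸ countBelow (λ j' → isLoop {k} j' ∧ not (inc P v j')) (toℕ j)
... | inj₂ e with remQuot k e
...   | (i , r) = if inc P v j then ownCost else
                    k * k ∸ countBelow (λ j' → not (isLoop {k} j') ∧ not (inc P v j')) (toℕ j)
  where
  -- e_j contains v and is a valid edge: it is the ℓ-th best edge at v, value k+1-ℓ
  ownCost : ℕ
  ownCost with splitAt k v
  ... | inj₁ m = k ∸ toℕ r                       -- ℓ = r + 1
  ... | inj₂ w = k ∸ toℕ (women P w ⟨$⟩ˡ i)      -- ℓ = 1 + position of m_i for w

Amat : ∀ {k} → Prefs k → Vtx k → Col k → ℚ
Amat P v j = if inc P v j then 1ℚ else 0ℚ

sumℚ : ∀ {m} → (Fin m → ℚ) → ℚ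
sumℚ {zero} f = 0ℚ
sumℚ {suc m} f = f zero ℚ.+ sumℚ (λ j → f (suc j))

Ax : ∀ {k} → Prefs k → (Col k → ℚ) → Vtx k → ℚ
Ax P x v = sumℚ (λ j → Amat P v j ℚ.* x j)

SupportedOn : ∀ {k} → Subset ((k + k) + k * k) → (Col k → ℚ) → Set
SupportedOn {k} B x = ∀ j → j ∉ B → x j ≡ 0ℚ

LinIndepCols : ∀ {k} → Prefs k → Subset ((k + k) + k * k) → Set
LinIndepCols {k} P B = ∀ x → SupportedOn {k} B x → (∀ v → Ax P x v ≡ 0ℚ) → ∀ j → x j ≡ 0ℚ

-- feasible basis: n linearly independent columns with A_B^{-1} b ≥ 0,
-- i.e. the (unique) solution of A_B x_B = b is nonnegative
FeasibleBasis : ∀ {k} → Prefs k → Subset ((k + k) + k * k) → Set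
FeasibleBasis {k} P B =
  ∣ B ∣ ≡ k + k × LinIndepCols P B ×
  ∃[ x ] (SupportedOn {k} B x × (∀ j → 0ℚ ℚ.≤ x j) × (∀ v → Ax P x v ≡ 1ℚ))

minOn : ∀ {m} → Subset m → (Fin m → ℕ) → Maybe ℕ
minOn [] f = nothing
minOn (outside ∷ D) f = minOn D (λ j → f (suc j))
minOn (inside ∷ D) f with minOn D (λ j → f (suc j))
... | nothing = just (f zero)
... | just a = just (Nat._⊓_ (f zero) a)

-- utility vector u_v = min_{j ∈ D} c_{vj}   (D is nonempty whenever used)
util : ∀ {k} → Prefs k → Subset ((k + k) + k * k) → Vtx k → ℕ
util {k} P D v = fromMaybe 0 (minOn D (cost {k} P v))

OrdinalBasis : ∀ {k} → Prefs k → Subset ((k + k) + k * k) → Set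
OrdinalBasis {k} P D =
  ∣ D ∣ ≡ k + k × (∀ h → ∃[ v ] (cost P v h ≤ util P D v))

-- "column 1" is the column with 0-based index 0, i.e. the loop e_1 at m_1
AlmostFeasible : ∀ {k} → Prefs k → Subset ((k + k) + k * k) → Set
AlmostFeasible {k} P D =
  OrdinalBasis P D × (∀ (j : Col k) → toℕ j ≡ 0 → j ∉ D) ×
  ∃[ B ] (FeasibleBasis P B × (∃[ j ] (toℕ j ≡ 0 × j ∈ B)) × ∣ B ∩ D ∣ ≡ (k + k) ∸ 1)

HasLoop : ∀ {k} → Subset ((k + k) + k * k) → Fin k → Set
HasLoop {k} D i = loopCol {k} (man i) ∈ D

HasValid : ∀ {k} → Subset ((k + k) + k * k) → Fin k → Set
HasValid {k} D i = ∃[ r ] (edgeCol {k} i r ∈ D)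

-- Let u be the utility vector of D, m₁ the first man and x the solution of the feasible basis B.
-- Since ∣B ∩ D∣ = n − 1 and column 1 lies in B but not in D, x is supported on D ∪ {1}; hence
-- Ax = 1 forces every vertex other than m₁ to lie on a column of D, so its utility is at most k,
-- while u(m₁) > k keeps m₁ off every column of D.  The value u(m₁) ≤ k² is attained at a valid
-- edge j⋆ = (m_p, ·) of D.  Since m₁'s costs on the other men's edges decrease from left to
-- right, j⋆ is the rightmost valid edge of D and every valid edge to its left is dominated by one
-- of its endpoints; so the men after m_p have loops only.  If m_p had no loop, every column of D
-- would be tight for a distinct vertex other than m₁, giving ∣D∣ < n.  Weighting Ax = 1 by +1 on
-- men and −1 on women shows that D contains the loop of some woman w; a man m_i before m_p with
-- a loop would leave the edge (m_i, w) undominated, so these men have valid edges only.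

module Submission where

open import Defs
open import Algebra.Bundles using (CommutativeRing)
import Algebra.Properties.Semiring.Sum
open import Data.Bool using (Bool; true; false; if_then_else_; _∧_; not)
open import Data.Bool.Properties using (∧-identityʳ) renaming (_≟_ to _≟ᵇ_)
open import Data.Empty using (⊥-elim)
open import Data.Fin using (Fin; zero; suc; toℕ; _↑ˡ_; _↑ʳ_; _≟_; splitAt; join; combine; quotRem; remQuot)
open import Data.Fin.Permutation using (Permutation; _⟨$⟩ʳ_; _⟨$⟩ˡ_; inverseˡ; inverseʳ)
open import Data.Fin.Properties
  using (suc-injective; 0≢1+n; toℕ-injective; toℕ<n; toℕ-↑ˡ; toℕ-↑ʳ; ↑ˡ-injective; ↑ʳ-injective;
         splitAt-↑ˡ; splitAt-↑ʳ; join-splitAt; remQuot-combine; combine-remQuot; toℕ-combine;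
         combine-monoˡ-<; combine-injective; any?)
open import Data.Fin.Subset using (Subset; _∈_; _∉_; _∩_; _-_; ∣_∣; inside; outside)
open import Data.Fin.Subset.Properties using (_∈?_; p⊆q⇒∣p∣≤∣q∣; x∈p⇒∣p-x∣<∣p∣; x∈p∧x≢y⇒x∈p-y; x∈p∩q⁻)
open import Data.Maybe using (just; nothing)
open import Data.Nat using (ℕ; zero; suc; _+_; _*_; _∸_; _≤_; _<_; _⊓_; z≤n; s≤s)
open import Data.Nat.Properties
  using (≤-refl; ≤-trans; ≤-reflexive; ≤-antisym; ≤-total; <⇒≤; <⇒≢; <⇒≱; ≮⇒≥; <-cmp; 1+n≰n;
         m⊓n≤m; m⊓n≤n; m≤n⇒m⊓n≡m; m≥n⇒m⊓n≡n; +-assoc; +-comm; +-suc; +-identityʳ; +-monoʳ-≤; +-monoˡ-≤;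
         +-monoʳ-<; +-cancelˡ-≤; m≤m+n; m<m+n; m≤m*n; m∸n≤m; m<n⇒0<n∸m; ∸-monoʳ-≤; ∸-monoʳ-<; ∸-cancelˡ-≡;
         m+n≤o⇒m≤o∸n; module ≤-Reasoning)
open import Data.Product using (_×_; _,_; ∃-syntax; Σ-syntax; proj₁; proj₂; swap)
open import Data.Rational using (ℚ; 0ℚ; 1ℚ; -_) renaming (_+_ to _+ℚ_; _*_ to _*ℚ_; _≤_ to _≤ℚ_)
import Data.Rational.Properties as ℚ
open import Data.Sum using (_⊎_; inj₁; inj₂)
open import Data.Vec using ([]; _∷_; lookup; here; there)
open import Data.Vec.Properties using (lookup⇒[]=)
open import Function using (_∘_)
open import Relation.Binary.Definitions using (tri<; tri≈; tri>)
open import Relation.Binary.PropositionalEquality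
open import Relation.Nullary using (¬_; yes; no; contradiction)
open import Relation.Nullary.Decidable using (⌊_⌋; _×-dec_)

-- Counting Boolean predicates on Fin

[_]⁰¹ : Bool → ℕ
[ b ]⁰¹ = if b then 1 else 0

count : ∀ {m} → (Fin m → Bool) → ℕ
count {zero}  p = 0
count {suc m} p = [ p zero ]⁰¹ + count (p ∘ suc)

countBelow≤count : ∀ {m} (p : Fin m → Bool) t → countBelow p t ≤ count p
countBelow≤count {zero}  p t       = z≤n
countBelow≤count {suc m} p zero    = z≤n
countBelow≤count {suc m} p (suc t) = +-monoʳ-≤ [ p zero ]⁰¹ (countBelow≤count (p ∘ suc) t)

countBelow-< : ∀ {m} (p : Fin m → Bool) (h : Fin m) t →
  toℕ h < t → p h ≡ true → countBelow p (toℕ h) < countBelow p t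
countBelow-< p zero    (suc t) _ ph rewrite ph = s≤s z≤n
countBelow-< p (suc h) (suc t) (s≤s h<t) ph =
  subst (_≤ [ p zero ]⁰¹ + countBelow (p ∘ suc) t) (+-suc [ p zero ]⁰¹ _)
    (+-monoʳ-≤ [ p zero ]⁰¹ (countBelow-< (p ∘ suc) h t h<t ph))

countBelow<count : ∀ {m} (p : Fin m → Bool) (h : Fin m) →
  p h ≡ true → countBelow p (toℕ h) < count p
countBelow<count p h ph =
  ≤-trans (countBelow-< p h (suc (toℕ h)) ≤-refl ph) (countBelow≤count p _)

count-cong : ∀ {m} {p q : Fin m → Bool} → (∀ j → p j ≡ q j) → count p ≡ count q
count-cong {zero}  p≗q = refl
count-cong {suc m} p≗q = cong₂ _+_ (cong [_]⁰¹ (p≗q zero)) (count-cong (p≗q ∘ suc))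

count-true : ∀ m → count {m} (λ _ → true) ≡ m
count-true zero    = refl
count-true (suc m) = cong suc (count-true m)

count-false : ∀ {m} (p : Fin m → Bool) → (∀ j → p j ≡ false) → count p ≡ 0
count-false {zero}  p _  = refl
count-false {suc m} p p≡f rewrite p≡f zero = count-false (p ∘ suc) (p≡f ∘ suc)

count-↑ : ∀ a {b} (p : Fin (a + b) → Bool) →
  count p ≡ count (λ j → p (j ↑ˡ b)) + count (λ j → p (a ↑ʳ j))
count-↑ zero    p = refl
count-↑ (suc a) p =
  trans (cong ([ p zero ]⁰¹ +_) (count-↑ a (p ∘ suc))) (sym (+-assoc [ p zero ]⁰¹ _ _))

count-∧-partition : ∀ {m} (p q : Fin m → Bool) →
  count p ≡ count (λ j → p j ∧ q j) + count (λ j → p j ∧ not (q j))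
count-∧-partition {zero}  p q = refl
count-∧-partition {suc m} p q
  with p zero | q zero | count-∧-partition (p ∘ suc) (q ∘ suc)
... | true  | true  | ih = cong suc ih
... | true  | false | ih = trans (cong suc ih) (sym (+-suc _ _))
... | false | true  | ih = ih
... | false | false | ih = ih

_-⁅_⁆ : ∀ {m} → (Fin m → Bool) → Fin m → (Fin m → Bool)
(q -⁅ b ⁆) j = q j ∧ not ⌊ j ≟ b ⌋

-⁅⁆-suc : ∀ {m} (q : Fin (suc m) → Bool) b j → ((q -⁅ suc b ⁆) ∘ suc) j ≡ ((q ∘ suc) -⁅ b ⁆) j
-⁅⁆-suc q b j with j ≟ b
... | yes _ = refl
... | no  _ = refl

-⁅⁆-true : ∀ {m} (q : Fin m → Bool) {b j} → q j ≡ true → j ≢ b → (q -⁅ b ⁆) j ≡ true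
-⁅⁆-true q {b} {j} qj j≢b with j ≟ b
... | yes j≡b = contradiction j≡b j≢b
... | no  _   rewrite qj = refl

count-remove : ∀ {m} (q : Fin m → Bool) b → q b ≡ true → count q ≡ suc (count (q -⁅ b ⁆))
count-remove q zero qb rewrite qb = cong suc (count-cong (λ j → sym (∧-identityʳ (q (suc j)))))
count-remove q (suc b) qb = begin
  [ q zero ]⁰¹ + count (q ∘ suc)                 ≡⟨ cong ([ q zero ]⁰¹ +_) (count-remove (q ∘ suc) b qb) ⟩
  [ q zero ]⁰¹ + suc (count ((q ∘ suc) -⁅ b ⁆))  ≡⟨ +-suc _ _ ⟩
  suc ([ q zero ]⁰¹ + count ((q ∘ suc) -⁅ b ⁆))  ≡⟨ cong₂ (λ x y → suc ([ x ]⁰¹ + y))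
                                                      (sym (∧-identityʳ (q zero))) (count-cong (sym ∘ -⁅⁆-suc q b)) ⟩
  suc (count (q -⁅ suc b ⁆))                     ∎
  where open ≡-Reasoning

injection⇒count≤count : ∀ {a b} (p : Fin a → Bool) (q : Fin b → Bool) (R : Fin a → Fin b → Set) →
  (∀ x → p x ≡ true → ∃[ y ] (q y ≡ true × R x y)) →
  (∀ {x x′ y} → p x ≡ true → p x′ ≡ true → R x y → R x′ y → x ≡ x′) →
  count p ≤ count q
injection⇒count≤count {zero}  p q R cover inj = z≤n
injection⇒count≤count {suc a} p q R cover inj with p zero in p₀
... | false = injection⇒count≤count (p ∘ suc) q (R ∘ suc) (cover ∘ suc)
                (λ px px′ Rxy Rx′y → suc-injective (inj px px′ Rxy Rx′y))
... | true with cover zero p₀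
...   | y₀ , qy₀ , Ry₀ = subst (suc (count (p ∘ suc)) ≤_) (sym (count-remove q y₀ qy₀))
          (s≤s (injection⇒count≤count (p ∘ suc) (q -⁅ y₀ ⁆) (R ∘ suc) cover′
                  (λ px px′ Rxy Rx′y → suc-injective (inj px px′ Rxy Rx′y))))
  where
  cover′ : ∀ x → p (suc x) ≡ true → ∃[ y ] ((q -⁅ y₀ ⁆) y ≡ true × R (suc x) y)
  cover′ x px with cover (suc x) px
  ... | y , qy , Rxy = y , -⁅⁆-true q qy (λ { refl → 0≢1+n (inj p₀ px Ry₀ Rxy) }) , Rxy

∣S∣≡count : ∀ {m} (S : Subset m) → ∣ S ∣ ≡ count (lookup S)
∣S∣≡count []            = refl
∣S∣≡count (inside ∷ S)  = cong suc (∣S∣≡count S)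
∣S∣≡count (outside ∷ S) = ∣S∣≡count S

-- Finite sums of rationals

module Σℚ = Algebra.Properties.Semiring.Sum (CommutativeRing.semiring ℚ.+-*-commutativeRing)

sumℚ≡sum : ∀ {m} (f : Fin m → ℚ) → sumℚ f ≡ Σℚ.sum f
sumℚ≡sum {zero}  f = refl
sumℚ≡sum {suc m} f = cong (f zero +ℚ_) (sumℚ≡sum (f ∘ suc))

sumℚ-cong : ∀ {m} {f g : Fin m → ℚ} → (∀ j → f j ≡ g j) → sumℚ f ≡ sumℚ g
sumℚ-cong {zero}  f≗g = refl
sumℚ-cong {suc m} f≗g = cong₂ _+ℚ_ (f≗g zero) (sumℚ-cong (f≗g ∘ suc))

sumℚ-zero : ∀ {m} (f : Fin m → ℚ) → (∀ j → f j ≡ 0ℚ) → sumℚ f ≡ 0ℚ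
sumℚ-zero {zero}  f f≡0 = refl
sumℚ-zero {suc m} f f≡0 = trans (cong₂ _+ℚ_ (f≡0 zero) (sumℚ-zero (f ∘ suc) (f≡0 ∘ suc))) (ℚ.+-identityˡ 0ℚ)

sumℚ-↑ : ∀ a {b} (f : Fin (a + b) → ℚ) →
  sumℚ f ≡ sumℚ (λ j → f (j ↑ˡ b)) +ℚ sumℚ (λ j → f (a ↑ʳ j))
sumℚ-↑ zero    f = sym (ℚ.+-identityˡ _)
sumℚ-↑ (suc a) f = trans (cong (f zero +ℚ_) (sumℚ-↑ a (f ∘ suc))) (sym (ℚ.+-assoc (f zero) _ _))

sumℚ-distrib-+ : ∀ {m} (f g : Fin m → ℚ) → sumℚ (λ j → f j +ℚ g j) ≡ sumℚ f +ℚ sumℚ g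
sumℚ-distrib-+ f g = begin
  sumℚ (λ j → f j +ℚ g j)   ≡⟨ sumℚ≡sum (λ j → f j +ℚ g j) ⟩
  Σℚ.sum (λ j → f j +ℚ g j) ≡⟨ Σℚ.∑-distrib-+ f g ⟩
  Σℚ.sum f +ℚ Σℚ.sum g      ≡⟨ cong₂ _+ℚ_ (sumℚ≡sum f) (sumℚ≡sum g) ⟨
  sumℚ f +ℚ sumℚ g          ∎
  where open ≡-Reasoning

sumℚ-indicator : ∀ {m} (l : Fin m) (c : Fin m → ℚ) →
  sumℚ (λ j → if ⌊ j ≟ l ⌋ then c j else 0ℚ) ≡ c l
sumℚ-indicator {suc m} zero c =
  trans (cong (c zero +ℚ_) (sumℚ-zero (λ (j : Fin m) → if ⌊ suc j ≟ zero ⌋ then c (suc j) else 0ℚ) (λ _ → refl)))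
        (ℚ.+-identityʳ (c zero))
sumℚ-indicator {suc m} (suc l) c =
  trans (ℚ.+-identityˡ _) (trans (sumℚ-cong shift) (sumℚ-indicator l (c ∘ suc)))
  where
  shift : ∀ j → (if ⌊ suc j ≟ suc l ⌋ then c (suc j) else 0ℚ) ≡ (if ⌊ j ≟ l ⌋ then c (suc j) else 0ℚ)
  shift j with j ≟ l
  ... | yes _ = refl
  ... | no  _ = refl

*-indicator : ∀ (b : Bool) c → c *ℚ (if b then 1ℚ else 0ℚ) ≡ (if b then c else 0ℚ)
*-indicator true  c = ℚ.*-identityʳ c
*-indicator false c = ℚ.*-zeroʳ c

sumℚ-transpose : ∀ {a b} (w : Fin a → ℚ) (M : Fin a → Fin b → ℚ) (x : Fin b → ℚ) →
  sumℚ (λ v → w v *ℚ sumℚ (λ j → M v j *ℚ x j)) ≡ sumℚ (λ j → sumℚ (λ v → w v *ℚ M v j) *ℚ x j)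
sumℚ-transpose w M x = begin
  sumℚ (λ v → w v *ℚ sumℚ (λ j → M v j *ℚ x j))
    ≡⟨ sumℚ≡sum (λ v → w v *ℚ sumℚ (λ j → M v j *ℚ x j)) ⟩
  Σℚ.sum (λ v → w v *ℚ sumℚ (λ j → M v j *ℚ x j))
    ≡⟨ Σℚ.sum-cong-≗ (λ v → trans (cong (w v *ℚ_) (sumℚ≡sum (λ j → M v j *ℚ x j)))
                                  (Σℚ.*-distribˡ-sum (w v) (λ j → M v j *ℚ x j))) ⟩
  Σℚ.sum (λ v → Σℚ.sum (λ j → w v *ℚ (M v j *ℚ x j)))
    ≡⟨ Σℚ.∑-comm (λ v j → w v *ℚ (M v j *ℚ x j)) ⟩
  Σℚ.sum (λ j → Σℚ.sum (λ v → w v *ℚ (M v j *ℚ x j)))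
    ≡⟨ Σℚ.sum-cong-≗ (λ j → trans (Σℚ.sum-cong-≗ (λ v → sym (ℚ.*-assoc (w v) (M v j) (x j))))
                                  (sym (Σℚ.*-distribʳ-sum (x j) (λ v → w v *ℚ M v j)))) ⟩
  Σℚ.sum (λ j → Σℚ.sum (λ v → w v *ℚ M v j) *ℚ x j)
    ≡⟨ Σℚ.sum-cong-≗ (λ j → cong (_*ℚ x j) (sumℚ≡sum (λ v → w v *ℚ M v j))) ⟨
  Σℚ.sum (λ j → sumℚ (λ v → w v *ℚ M v j) *ℚ x j)
    ≡⟨ sumℚ≡sum (λ j → sumℚ (λ v → w v *ℚ M v j) *ℚ x j) ⟨
  sumℚ (λ j → sumℚ (λ v → w v *ℚ M v j) *ℚ x j)
    ∎
  where open ≡-Reasoning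

0≤sumℚ : ∀ {m} (f : Fin m → ℚ) → (∀ j → 0ℚ ≤ℚ f j) → 0ℚ ≤ℚ sumℚ f
0≤sumℚ {zero}  f f≥0 = ℚ.≤-refl
0≤sumℚ {suc m} f f≥0 = subst (_≤ℚ sumℚ f) (ℚ.+-identityˡ 0ℚ)
                         (ℚ.+-mono-≤ (f≥0 zero) (0≤sumℚ (f ∘ suc) (f≥0 ∘ suc)))

≤-sumℚ : ∀ {m} (f : Fin m → ℚ) → (∀ j → 0ℚ ≤ℚ f j) → ∀ j → f j ≤ℚ sumℚ f
≤-sumℚ {suc m} f f≥0 zero    = subst (_≤ℚ sumℚ f) (ℚ.+-identityʳ (f zero))
                                  (ℚ.+-mono-≤ (ℚ.≤-refl {f zero}) (0≤sumℚ (f ∘ suc) (f≥0 ∘ suc)))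
≤-sumℚ {suc m} f f≥0 (suc j) = subst (_≤ℚ sumℚ f) (ℚ.+-identityˡ (f (suc j)))
                                  (ℚ.+-mono-≤ (f≥0 zero) (≤-sumℚ (f ∘ suc) (f≥0 ∘ suc) j))

1ℚ≰0ℚ : ¬ (1ℚ ≤ℚ 0ℚ)
1ℚ≰0ℚ 1≤0 = ℚ.<-irrefl refl (ℚ.<-≤-trans (ℚ.positive⁻¹ 1ℚ) 1≤0)

≟-true : ∀ {n} {a b : Fin n} → ⌊ a ≟ b ⌋ ≡ true → a ≡ b
≟-true {a = a} {b} eq with a ≟ b
... | yes a≡b = a≡b

≟-false : ∀ {n} {a b : Fin n} → a ≢ b → ⌊ a ≟ b ⌋ ≡ false
≟-false {a = a} {b} a≢b with a ≟ b
... | yes a≡b = contradiction a≡b a≢b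
... | no  _   = refl

≟-refl : ∀ {n} (a : Fin n) → ⌊ a ≟ a ⌋ ≡ true
≟-refl a with a ≟ a
... | yes _   = refl
... | no  a≢a = contradiction refl a≢a

m≤m*m : ∀ m → m ≤ m * m
m≤m*m zero      = z≤n
m≤m*m m@(suc _) = m≤m*n m m

⟨$⟩ʳ-injective : ∀ {m n} (π : Permutation m n) {i j} → π ⟨$⟩ʳ i ≡ π ⟨$⟩ʳ j → i ≡ j
⟨$⟩ʳ-injective π eq = trans (sym (inverseˡ π)) (trans (cong (π ⟨$⟩ˡ_) eq) (inverseˡ π))

⟨$⟩ˡ-injective : ∀ {m n} (π : Permutation m n) {i j} → π ⟨$⟩ˡ i ≡ π ⟨$⟩ˡ j → i ≡ j
⟨$⟩ˡ-injective π eq = trans (sym (inverseʳ π)) (trans (cong (π ⟨$⟩ʳ_) eq) (inverseʳ π))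

∸toℕ-injective : ∀ {n} {x y : Fin n} → n ∸ toℕ x ≡ n ∸ toℕ y → x ≡ y
∸toℕ-injective {x = x} {y} eq = toℕ-injective (∸-cancelˡ-≡ (<⇒≤ (toℕ<n x)) (<⇒≤ (toℕ<n y)) eq)

1≤toℕ⇒≢zero : ∀ {n} {i : Fin (suc n)} → 1 ≤ toℕ i → i ≢ zero
1≤toℕ⇒≢zero () refl

≢zero⇒1≤toℕ : ∀ {n} {i : Fin (suc n)} → i ≢ zero → 1 ≤ toℕ i
≢zero⇒1≤toℕ {i = zero}  i≢0 = contradiction refl i≢0
≢zero⇒1≤toℕ {i = suc _} _   = s≤s z≤n

2+[n∸1]≰n : ∀ n → ¬ (suc (suc (n ∸ 1)) ≤ n)
2+[n∸1]≰n zero    ()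
2+[n∸1]≰n (suc n) (s≤s n<n) = 1+n≰n n<n

minOn-≤ : ∀ {m} (S : Subset m) (f : Fin m → ℕ) {j} → j ∈ S → ∃[ a ] (minOn S f ≡ just a × a ≤ f j)
minOn-≤ (inside ∷ S) f here with minOn S (f ∘ suc)
... | nothing = f zero , refl , ≤-refl
... | just a  = f zero ⊓ a , refl , m⊓n≤m (f zero) a
minOn-≤ (outside ∷ S) f (there j∈S) = minOn-≤ S (f ∘ suc) j∈S
minOn-≤ (inside ∷ S) f (there j∈S) with minOn S (f ∘ suc) | minOn-≤ S (f ∘ suc) j∈S
... | just a | .a , refl , a≤fj = f zero ⊓ a , refl , ≤-trans (m⊓n≤n (f zero) a) a≤fj

minOn-attained : ∀ {m} (S : Subset m) (f : Fin m → ℕ) {a} → minOn S f ≡ just a → ∃[ j ] (j ∈ S × a ≡ f j)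
minOn-attained (outside ∷ S) f eq with minOn-attained S (f ∘ suc) eq
... | j , j∈S , a≡fj = suc j , there j∈S , a≡fj
minOn-attained (inside ∷ S) f eq with minOn S (f ∘ suc) in eqS
minOn-attained (inside ∷ S) f refl | nothing = zero , here , refl
minOn-attained (inside ∷ S) f refl | just b with ≤-total (f zero) b
... | inj₁ f₀≤b = zero , here , m≤n⇒m⊓n≡m f₀≤b
... | inj₂ b≤f₀ with minOn-attained S (f ∘ suc) eqS
...   | j , j∈S , b≡fj = suc j , there j∈S , trans (m≥n⇒m⊓n≡n b≤f₀) b≡fj

module Layout (k : ℕ) where

  data VtxView : Vtx k → Set where
    isMan   : (a : Fin k) → VtxView (man {k} a)
    isWoman : (w : Fin k) → VtxView (woman {k} w)

  vtxView : (v : Vtx k) → VtxView v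
  vtxView v with splitAt k v in eq
  ... | inj₁ a = subst VtxView (trans (sym (cong (join k k) eq)) (join-splitAt k k v)) (isMan a)
  ... | inj₂ w = subst VtxView (trans (sym (cong (join k k) eq)) (join-splitAt k k v)) (isWoman w)

  data ColView : Col k → Set where
    loop : (v : Vtx k) → ColView (loopCol {k} v)
    edge : (i r : Fin k) → ColView (edgeCol {k} i r)

  colView : (j : Col k) → ColView j
  colView j with splitAt (k + k) j in eq
  ... | inj₁ v = subst ColView (trans (sym (cong (join (k + k) (k * k)) eq)) (join-splitAt (k + k) (k * k) j)) (loop v)
  ... | inj₂ e = subst ColView
          (trans (cong ((k + k) ↑ʳ_) (combine-remQuot {k} k e))
                 (trans (sym (cong (join (k + k) (k * k)) eq)) (join-splitAt (k + k) (k * k) j)))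
          (edge (proj₁ (remQuot {k} k e)) (proj₂ (remQuot {k} k e)))

  splitAt-man : ∀ a → splitAt k (man {k} a) ≡ inj₁ a
  splitAt-man a = splitAt-↑ˡ k a k

  splitAt-woman : ∀ w → splitAt k (woman {k} w) ≡ inj₂ w
  splitAt-woman w = splitAt-↑ʳ k k w

  splitAt-loopCol : ∀ v → splitAt (k + k) (loopCol {k} v) ≡ inj₁ v
  splitAt-loopCol v = splitAt-↑ˡ (k + k) v (k * k)

  splitAt-edgeCol : ∀ i r → splitAt (k + k) (edgeCol {k} i r) ≡ inj₂ (combine i r)
  splitAt-edgeCol i r = splitAt-↑ʳ (k + k) (k * k) (combine i r)

  quotRem-combine : ∀ (i r : Fin k) → quotRem k (combine i r) ≡ (r , i)
  quotRem-combine i r = cong swap (remQuot-combine i r)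

  man≢woman : ∀ a w → man {k} a ≢ woman {k} w
  man≢woman a w eq with trans (sym (splitAt-man a)) (trans (cong (splitAt k) eq) (splitAt-woman w))
  ... | ()

  man-injective : ∀ {a a′} → man {k} a ≡ man {k} a′ → a ≡ a′
  man-injective = ↑ˡ-injective k _ _

  loopCol-injective : ∀ {v v′} → loopCol {k} v ≡ loopCol {k} v′ → v ≡ v′
  loopCol-injective = ↑ˡ-injective (k * k) _ _

  edgeCol-injective : ∀ {i r i′ r′} → edgeCol {k} i r ≡ edgeCol {k} i′ r′ → i ≡ i′ × r ≡ r′
  edgeCol-injective eq = combine-injective _ _ _ _ (↑ʳ-injective (k + k) _ _ eq)

  toℕ-edgeCol : ∀ i r → toℕ (edgeCol {k} i r) ≡ (k + k) + (k * toℕ i + toℕ r)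
  toℕ-edgeCol i r = trans (toℕ-↑ʳ (k + k) (combine i r)) (cong ((k + k) +_) (toℕ-combine i r))

  edgeCol-<-man : ∀ {i i′} r r′ → toℕ i < toℕ i′ → toℕ (edgeCol {k} i r) < toℕ (edgeCol {k} i′ r′)
  edgeCol-<-man r r′ i<i′ = subst₂ _<_ (sym (toℕ-↑ʳ (k + k) _)) (sym (toℕ-↑ʳ (k + k) _))
    (+-monoʳ-< (k + k) (combine-monoˡ-< r r′ i<i′))

  edgeCol-≤-rank : ∀ i {r r′} → toℕ (edgeCol {k} i r) ≤ toℕ (edgeCol {k} i r′) → toℕ r ≤ toℕ r′
  edgeCol-≤-rank i le = +-cancelˡ-≤ (k * toℕ i) _ _
    (+-cancelˡ-≤ (k + k) _ _ (subst₂ _≤_ (toℕ-edgeCol i _) (toℕ-edgeCol i _) le))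

module Costs {k : ℕ} (P : Prefs k) where

  open Layout k

  inc-loopCol : ∀ v l → inc P v (loopCol {k} l) ≡ ⌊ v ≟ l ⌋
  inc-loopCol v l rewrite splitAt-loopCol l = refl

  inc-man-edgeCol : ∀ a i r → inc P (man {k} a) (edgeCol {k} i r) ≡ ⌊ a ≟ i ⌋
  inc-man-edgeCol a i r rewrite splitAt-edgeCol i r | quotRem-combine i r | splitAt-man a = refl

  inc-woman-edgeCol : ∀ w i r → inc P (woman {k} w) (edgeCol {k} i r) ≡ ⌊ w ≟ men P i ⟨$⟩ʳ r ⌋
  inc-woman-edgeCol w i r rewrite splitAt-edgeCol i r | quotRem-combine i r | splitAt-woman w = refl

  inc-loopCol-own : ∀ v → inc P v (loopCol {k} v) ≡ true
  inc-loopCol-own v = trans (inc-loopCol v v) (≟-refl v)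

  inc-edgeCol-own : ∀ i r → inc P (man {k} i) (edgeCol {k} i r) ≡ true
  inc-edgeCol-own i r = trans (inc-man-edgeCol i i r) (≟-refl i)

  isLoop-loopCol : ∀ v → isLoop {k} (loopCol {k} v) ≡ true
  isLoop-loopCol v rewrite splitAt-loopCol v = refl

  isLoop-↑ʳ : ∀ e → isLoop {k} ((k + k) ↑ʳ e) ≡ false
  isLoop-↑ʳ e rewrite splitAt-↑ʳ (k + k) (k * k) e = refl

  cost-loopCol-own : ∀ v → cost P v (loopCol {k} v) ≡ 0
  cost-loopCol-own v rewrite splitAt-loopCol v | ≟-refl v = refl

  cost-man-edgeCol : ∀ i r → cost P (man {k} i) (edgeCol {k} i r) ≡ k ∸ toℕ r
  cost-man-edgeCol i r
    rewrite splitAt-edgeCol i r | quotRem-combine i r | splitAt-man i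
          | splitAt-edgeCol i r | quotRem-combine i r | splitAt-man i | ≟-refl i = refl

  cost-woman-edgeCol : ∀ w i r → men P i ⟨$⟩ʳ r ≡ w →
    cost P (woman {k} w) (edgeCol {k} i r) ≡ k ∸ toℕ (women P w ⟨$⟩ˡ i)
  cost-woman-edgeCol w i r refl
    rewrite splitAt-edgeCol i r | quotRem-combine i r | splitAt-woman (men P i ⟨$⟩ʳ r)
          | splitAt-edgeCol i r | quotRem-combine i r | splitAt-woman (men P i ⟨$⟩ʳ r)
          | ≟-refl (men P i ⟨$⟩ʳ r) = refl

  incident-loopCol : ∀ {v l} → inc P v (loopCol {k} l) ≡ true → v ≡ l
  incident-loopCol {v} {l} eq = ≟-true (trans (sym (inc-loopCol v l)) eq)

  man-incident-edgeCol : ∀ {a i r} → inc P (man {k} a) (edgeCol {k} i r) ≡ true → a ≡ i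
  man-incident-edgeCol {a} {i} {r} eq = ≟-true (trans (sym (inc-man-edgeCol a i r)) eq)

  woman-incident-edgeCol : ∀ {w i r} → inc P (woman {k} w) (edgeCol {k} i r) ≡ true → w ≡ men P i ⟨$⟩ʳ r
  woman-incident-edgeCol {w} {i} {r} eq = ≟-true (trans (sym (inc-woman-edgeCol w i r)) eq)

  cost-incident-edgeCol : ∀ v i r → inc P v (edgeCol {k} i r) ≡ true →
    ∃[ t ] (cost P v (edgeCol {k} i r) ≡ k ∸ toℕ {k} t)
  cost-incident-edgeCol v i r eq with vtxView v
  ... | isMan a   rewrite man-incident-edgeCol eq = r , cost-man-edgeCol i r
  ... | isWoman w = women P w ⟨$⟩ˡ i , cost-woman-edgeCol w i r (sym (woman-incident-edgeCol eq))

  cost-incident-edgeCol-pos : ∀ v i r → inc P v (edgeCol {k} i r) ≡ true → 0 < cost P v (edgeCol {k} i r)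
  cost-incident-edgeCol-pos v i r eq with cost-incident-edgeCol v i r eq
  ... | t , c≡ rewrite c≡ = m<n⇒0<n∸m (toℕ<n t)

  cost-incident≤k : ∀ v j → inc P v j ≡ true → cost P v j ≤ k
  cost-incident≤k v j eq with colView j
  ... | loop l rewrite incident-loopCol eq | cost-loopCol-own l = z≤n
  ... | edge i r with cost-incident-edgeCol v i r eq
  ...   | t , c≡ rewrite c≡ = m∸n≤m k (toℕ t)

  cost-incident-injective : ∀ v {j j′} → inc P v j ≡ true → inc P v j′ ≡ true →
    cost P v j ≡ cost P v j′ → j ≡ j′
  cost-incident-injective v {j} {j′} e e′ c≡ with colView j | colView j′
  ... | loop l | loop l′ = cong (loopCol {k}) (trans (sym (incident-loopCol e)) (incident-loopCol e′))
  ... | loop l | edge i r rewrite incident-loopCol e =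
    contradiction (trans (sym (cost-loopCol-own l)) c≡) (<⇒≢ (cost-incident-edgeCol-pos l i r e′))
  ... | edge i r | loop l rewrite incident-loopCol e′ =
    contradiction (trans (sym (cost-loopCol-own l)) (sym c≡)) (<⇒≢ (cost-incident-edgeCol-pos l i r e))
  ... | edge i r | edge i′ r′ with vtxView v
  ...   | isMan a with man-incident-edgeCol e | man-incident-edgeCol e′
  ...     | refl | refl =
    cong (edgeCol {k} a) (∸toℕ-injective (trans (sym (cost-man-edgeCol a r)) (trans c≡ (cost-man-edgeCol a r′))))
  cost-incident-injective v e e′ c≡ | edge i r | edge i′ r′ | isWoman w
    with woman-incident-edgeCol e | woman-incident-edgeCol e′
  ... | w≡ | w≡′ with ⟨$⟩ˡ-injective (women P w) (∸toℕ-injective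
                        (trans (sym (cost-woman-edgeCol w i r (sym w≡)))
                               (trans c≡ (cost-woman-edgeCol w i′ r′ (sym w≡′)))))
  ...   | refl = cong (edgeCol {k} i) (⟨$⟩ʳ-injective (men P i) (trans (sym w≡) w≡′))

  nonincidentEdge : Vtx k → Col k → Bool
  nonincidentEdge v j = not (isLoop {k} j) ∧ not (inc P v j)

  nonincidentLoop : Vtx k → Col k → Bool
  nonincidentLoop v j = isLoop {k} j ∧ not (inc P v j)

  incidentEdge : Vtx k → Col k → Bool
  incidentEdge v j = not (isLoop {k} j) ∧ inc P v j

  incidentLoop : Vtx k → Col k → Bool
  incidentLoop v j = isLoop {k} j ∧ inc P v j

  count-isLoop : count (isLoop {k}) ≡ k + k
  count-isLoop = trans (count-↑ (k + k) (isLoop {k})) (trans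
    (cong₂ _+_ (trans (count-cong isLoop-loopCol) (count-true (k + k))) (count-false _ isLoop-↑ʳ))
    (+-identityʳ (k + k)))

  count-nonLoop : count (not ∘ isLoop {k}) ≡ k * k
  count-nonLoop = trans (count-↑ (k + k) (not ∘ isLoop {k}))
    (cong₂ _+_ (count-false _ (cong not ∘ isLoop-loopCol))
               (trans (count-cong (cong not ∘ isLoop-↑ʳ)) (count-true (k * k))))

  k≤count-incidentEdge : ∀ v → k ≤ count (incidentEdge v)
  k≤count-incidentEdge v with vtxView v
  ... | isMan a = subst (_≤ count (incidentEdge v)) (count-true k)
    (injection⇒count≤count (λ _ → true) (incidentEdge v) (λ r j → edgeCol {k} a r ≡ j)
      (λ r _ → edgeCol {k} a r , incident r , refl)
      (λ _ _ eq eq′ → proj₂ (edgeCol-injective (trans eq (sym eq′)))))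
    where
    incident : ∀ r → incidentEdge (man {k} a) (edgeCol {k} a r) ≡ true
    incident r rewrite isLoop-↑ʳ (combine a r) = inc-edgeCol-own a r
  ... | isWoman w = subst (_≤ count (incidentEdge v)) (count-true k)
    (injection⇒count≤count (λ _ → true) (incidentEdge v) (λ i j → edgeCol {k} i (men P i ⟨$⟩ˡ w) ≡ j)
      (λ i _ → edgeCol {k} i (men P i ⟨$⟩ˡ w) , incident i , refl)
      (λ _ _ eq eq′ → proj₁ (edgeCol-injective (trans eq (sym eq′)))))
    where
    incident : ∀ i → incidentEdge (woman {k} w) (edgeCol {k} i (men P i ⟨$⟩ˡ w)) ≡ true
    incident i rewrite isLoop-↑ʳ (combine i (men P i ⟨$⟩ˡ w)) | inc-woman-edgeCol w i (men P i ⟨$⟩ˡ w)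
                     | inverseʳ (men P i) {w} = ≟-refl w

  count-nonincidentEdge+k≤k² : ∀ v → count (nonincidentEdge v) + k ≤ k * k
  count-nonincidentEdge+k≤k² v = begin
    count (nonincidentEdge v) + k                       ≤⟨ +-monoʳ-≤ _ (k≤count-incidentEdge v) ⟩
    count (nonincidentEdge v) + count (incidentEdge v)  ≡⟨ +-comm _ (count (incidentEdge v)) ⟩
    count (incidentEdge v) + count (nonincidentEdge v)  ≡⟨ count-∧-partition (not ∘ isLoop {k}) (inc P v) ⟨
    count (not ∘ isLoop {k})                            ≡⟨ count-nonLoop ⟩
    k * k                                               ∎
    where open ≤-Reasoning

  count-nonincidentLoop<k+k : ∀ v → count (nonincidentLoop v) < k + k
  count-nonincidentLoop<k+k v = begin-strict
    count (nonincidentLoop v)                           <⟨ m<m+n _ 1≤count-incidentLoop ⟩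
    count (nonincidentLoop v) + count (incidentLoop v)  ≡⟨ +-comm _ (count (incidentLoop v)) ⟩
    count (incidentLoop v) + count (nonincidentLoop v)  ≡⟨ count-∧-partition (isLoop {k}) (inc P v) ⟨
    count (isLoop {k})                                  ≡⟨ count-isLoop ⟩
    k + k                                               ∎
    where
    open ≤-Reasoning
    1≤count-incidentLoop : 1 ≤ count (incidentLoop v)
    1≤count-incidentLoop rewrite count-remove (incidentLoop v) (loopCol {k} v)
      (cong₂ _∧_ (isLoop-loopCol v) (inc-loopCol-own v)) = s≤s z≤n

  cost-nonincident-edgeCol : ∀ v i r → inc P v (edgeCol {k} i r) ≡ false →
    cost P v (edgeCol {k} i r) ≡ k * k ∸ countBelow (nonincidentEdge v) (toℕ (edgeCol {k} i r))
  cost-nonincident-edgeCol v i r eq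
    rewrite splitAt-edgeCol i r | quotRem-combine i r | splitAt-edgeCol i r | quotRem-combine i r | eq = refl

  cost-nonincident-loopCol : ∀ v l → v ≢ l →
    cost P v (loopCol {k} l) ≡ (k * k + (k + k) ∸ 1) ∸ countBelow (nonincidentLoop v) (toℕ (loopCol {k} l))
  cost-nonincident-loopCol v l v≢l rewrite splitAt-loopCol l | ≟-false v≢l = refl

  nonincidentEdge-edgeCol : ∀ v i r → inc P v (edgeCol {k} i r) ≡ false →
    nonincidentEdge v (edgeCol {k} i r) ≡ true
  nonincidentEdge-edgeCol v i r eq rewrite isLoop-↑ʳ (combine i r) | eq = refl

  k<cost-nonincident-edgeCol : ∀ v i r → inc P v (edgeCol {k} i r) ≡ false → k < cost P v (edgeCol {k} i r)
  k<cost-nonincident-edgeCol v i r eq rewrite cost-nonincident-edgeCol v i r eq =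
    m+n≤o⇒m≤o∸n (suc k) (begin
      suc k + below      ≡⟨ cong suc (+-comm k below) ⟩
      suc below + k      ≤⟨ +-monoˡ-≤ k (countBelow<count (nonincidentEdge v) _ (nonincidentEdge-edgeCol v i r eq)) ⟩
      count (nonincidentEdge v) + k ≤⟨ count-nonincidentEdge+k≤k² v ⟩
      k * k              ∎)
    where
    open ≤-Reasoning
    below = countBelow (nonincidentEdge v) (toℕ (edgeCol {k} i r))

  k²<cost-nonincident-loopCol : ∀ v l → v ≢ l → k * k < cost P v (loopCol {k} l)
  k²<cost-nonincident-loopCol v l v≢l rewrite cost-nonincident-loopCol v l v≢l =
    m+n≤o⇒m≤o∸n (suc (k * k)) (m+n≤o⇒m≤o∸n (suc (k * k) + below) (begin
      suc (k * k) + below + 1     ≡⟨ +-comm _ 1 ⟩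
      suc (suc (k * k + below))   ≡⟨ cong suc (+-suc (k * k) below) ⟨
      suc (k * k + suc below)     ≡⟨ +-suc (k * k) (suc below) ⟨
      k * k + suc (suc below)     ≤⟨ +-monoʳ-≤ (k * k) (≤-trans (s≤s below<count) (count-nonincidentLoop<k+k v)) ⟩
      k * k + (k + k)             ∎))
    where
    open ≤-Reasoning
    below = countBelow (nonincidentLoop v) (toℕ (loopCol {k} l))
    below<count : below < count (nonincidentLoop v)
    below<count = countBelow<count (nonincidentLoop v) (loopCol {k} l)
      (cong₂ _∧_ (isLoop-loopCol l) (cong not (trans (inc-loopCol v l) (≟-false v≢l))))

  k<cost-nonincident : ∀ v j → inc P v j ≡ false → k < cost P v j
  k<cost-nonincident v j eq with colView j
  ... | edge i r = k<cost-nonincident-edgeCol v i r eq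
  ... | loop l   = ≤-trans (s≤s (m≤m*m k)) (k²<cost-nonincident-loopCol v l v≢l)
    where
    v≢l : v ≢ l
    v≢l refl = contradiction (trans (sym eq) (inc-loopCol-own v)) λ ()

  cost-nonincident-edgeCol-antitone : ∀ v {i r i′ r′} →
    inc P v (edgeCol {k} i r) ≡ false → inc P v (edgeCol {k} i′ r′) ≡ false →
    toℕ (edgeCol {k} i r) < toℕ (edgeCol {k} i′ r′) → cost P v (edgeCol {k} i′ r′) < cost P v (edgeCol {k} i r)
  cost-nonincident-edgeCol-antitone v {i} {r} {i′} {r′} eq eq′ lt
    rewrite cost-nonincident-edgeCol v i r eq | cost-nonincident-edgeCol v i′ r′ eq′ =
    ∸-monoʳ-< (countBelow-< (nonincidentEdge v) (edgeCol {k} i r) _ lt (nonincidentEdge-edgeCol v i r eq))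
      (≤-trans (countBelow≤count (nonincidentEdge v) _)
        (≤-trans (m≤m+n _ k) (count-nonincidentEdge+k≤k² v)))

module Utility {k : ℕ} (P : Prefs k) (D : Subset ((k + k) + k * k)) where

  open Costs P

  util≤cost : ∀ v {j} → j ∈ D → util P D v ≤ cost P v j
  util≤cost v j∈D with minOn-≤ D (cost P v) j∈D
  ... | a , eq , a≤c rewrite eq = a≤c

  util-attained : ∀ v {j₀} → j₀ ∈ D → ∃[ j ] (j ∈ D × util P D v ≡ cost P v j)
  util-attained v j₀∈D with minOn-≤ D (cost P v) j₀∈D
  ... | a , eq , _ with minOn-attained D (cost P v) eq
  ...   | j , j∈D , a≡c rewrite eq = j , j∈D , a≡c

  util≤0 : ∀ v → loopCol {k} v ∈ D → util P D v ≤ 0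
  util≤0 v loop∈D = subst (util P D v ≤_) (cost-loopCol-own v) (util≤cost v loop∈D)

  Tight : Col k → Vtx k → Set
  Tight j v = inc P v j ≡ true × cost P v j ≤ util P D v

  tight-injective : ∀ {v j j′} → j ∈ D → j′ ∈ D → Tight j v → Tight j′ v → j ≡ j′
  tight-injective {v} j∈D j′∈D (e , t) (e′ , t′) = cost-incident-injective v e e′
    (≤-antisym (≤-trans t (util≤cost v j′∈D)) (≤-trans t′ (util≤cost v j∈D)))

  tight-cover⇒∣D∣<n : ∀ v₀ → (∀ {j} → j ∈ D → ∃[ v ] (v ≢ v₀ × Tight j v)) → ∣ D ∣ < k + k
  tight-cover⇒∣D∣<n v₀ cover = begin-strict
    ∣ D ∣                              ≡⟨ ∣S∣≡count D ⟩
    count (lookup D)                   ≤⟨ injection⇒count≤count (lookup D) (all -⁅ v₀ ⁆) (λ j v → Tight j v)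
                                            cover′ (λ lj lj′ → tight-injective (lookup⇒∈ lj) (lookup⇒∈ lj′)) ⟩
    count (all -⁅ v₀ ⁆)                <⟨ ≤-reflexive (sym (count-remove all v₀ refl)) ⟩
    count all                          ≡⟨ count-true (k + k) ⟩
    k + k                              ∎
    where
    open ≤-Reasoning
    all : Vtx k → Bool
    all _ = true
    lookup⇒∈ : ∀ {j} → lookup D j ≡ true → j ∈ D
    lookup⇒∈ {j} = lookup⇒[]= j D
    cover′ : ∀ j → lookup D j ≡ true → ∃[ v ] ((all -⁅ v₀ ⁆) v ≡ true × Tight j v)
    cover′ j lj with cover (lookup⇒∈ lj)
    ... | v , v≢v₀ , tight = v , -⁅⁆-true all refl v≢v₀ , tight

module SignedColumns {k : ℕ} (P : Prefs k) where

  open Layout k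
  open Costs P

  sign : Vtx k → ℚ
  sign v with splitAt k v
  ... | inj₁ _ = 1ℚ
  ... | inj₂ _ = - 1ℚ

  sign-man : ∀ a → sign (man {k} a) ≡ 1ℚ
  sign-man a rewrite splitAt-man a = refl

  sign-woman : ∀ w → sign (woman {k} w) ≡ - 1ℚ
  sign-woman w rewrite splitAt-woman w = refl

  sumℚ-sign : sumℚ sign ≡ 0ℚ
  sumℚ-sign = begin
    sumℚ sign
      ≡⟨ sumℚ-↑ k sign ⟩
    sumℚ (λ a → sign (man {k} a)) +ℚ sumℚ (λ w → sign (woman {k} w))
      ≡⟨ cong₂ _+ℚ_ (sumℚ-cong sign-man) (sumℚ-cong sign-woman) ⟩
    sumℚ {k} (λ _ → 1ℚ) +ℚ sumℚ {k} (λ _ → - 1ℚ)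
      ≡⟨ sumℚ-distrib-+ {k} (λ _ → 1ℚ) (λ _ → - 1ℚ) ⟨
    sumℚ {k} (λ _ → 1ℚ +ℚ - 1ℚ)
      ≡⟨ sumℚ-zero {k} _ (λ _ → ℚ.+-inverseʳ 1ℚ) ⟩
    0ℚ ∎
    where open ≡-Reasoning

  signedColumn : Col k → ℚ
  signedColumn j = sumℚ (λ v → sign v *ℚ Amat P v j)

  signedColumn-incident : ∀ j → signedColumn j ≡ sumℚ (λ v → if inc P v j then sign v else 0ℚ)
  signedColumn-incident j = sumℚ-cong (λ v → *-indicator (inc P v j) (sign v))

  signedColumn-loopCol : ∀ l → signedColumn (loopCol {k} l) ≡ sign l
  signedColumn-loopCol l = begin
    signedColumn (loopCol {k} l)
      ≡⟨ signedColumn-incident (loopCol {k} l) ⟩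
    sumℚ (λ v → if inc P v (loopCol {k} l) then sign v else 0ℚ)
      ≡⟨ sumℚ-cong (λ v → cong (λ b → if b then sign v else 0ℚ) (inc-loopCol v l)) ⟩
    sumℚ (λ v → if ⌊ v ≟ l ⌋ then sign v else 0ℚ)
      ≡⟨ sumℚ-indicator l sign ⟩
    sign l ∎
    where open ≡-Reasoning

  signedColumn-edgeCol : ∀ i r → signedColumn (edgeCol {k} i r) ≡ 0ℚ
  signedColumn-edgeCol i r = begin
    signedColumn e
      ≡⟨ trans (signedColumn-incident e) (sumℚ-↑ k _) ⟩
    sumℚ (λ a → if inc P (man {k} a) e then sign (man {k} a) else 0ℚ)
      +ℚ sumℚ (λ w → if inc P (woman {k} w) e then sign (woman {k} w) else 0ℚ)
      ≡⟨ cong₂ _+ℚ_ (sumℚ-cong (λ a → cong₂ (λ b s → if b then s else 0ℚ) (inc-man-edgeCol a i r) (sign-man a)))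
                    (sumℚ-cong (λ w → cong₂ (λ b s → if b then s else 0ℚ) (inc-woman-edgeCol w i r) (sign-woman w))) ⟩
    sumℚ (λ a → if ⌊ a ≟ i ⌋ then 1ℚ else 0ℚ) +ℚ sumℚ (λ w → if ⌊ w ≟ men P i ⟨$⟩ʳ r ⌋ then - 1ℚ else 0ℚ)
      ≡⟨ cong₂ _+ℚ_ (sumℚ-indicator i (λ _ → 1ℚ)) (sumℚ-indicator (men P i ⟨$⟩ʳ r) (λ _ → - 1ℚ)) ⟩
    1ℚ +ℚ - 1ℚ
      ≡⟨ ℚ.+-inverseʳ 1ℚ ⟩
    0ℚ ∎
    where
    open ≡-Reasoning
    e = edgeCol {k} i r

module AlmostFeasibleOrdinalBasis
  {k : ℕ} (P : Prefs k) (D : Subset ((k + k) + k * k))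
  (∣D∣≡n : ∣ D ∣ ≡ k + k) (ordinal : ∀ h → ∃[ v ] (cost P v h ≤ util P D v))
  (m₁ : Fin k) (c₁∉D : loopCol {k} (man m₁) ∉ D)
  (B : Subset ((k + k) + k * k)) (∣B∣≡n : ∣ B ∣ ≡ k + k) (c₁∈B : loopCol {k} (man m₁) ∈ B)
  (∣B∩D∣≡n∸1 : ∣ B ∩ D ∣ ≡ (k + k) ∸ 1)
  (x : Col k → ℚ) (x-supported : SupportedOn {k} B x) (x≥0 : ∀ j → 0ℚ ≤ℚ x j) (Ax≡1 : ∀ v → Ax P x v ≡ 1ℚ)
  (k<u₁ : k < util P D (man m₁)) (u₁≤k² : util P D (man m₁) ≤ k * k)
  {j₀ : Col k} (j₀∈D : j₀ ∈ D)
  where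

  open Layout k
  open Costs P
  open Utility P D
  open SignedColumns P

  v₁ : Vtx k
  v₁ = man m₁

  c₁ : Col k
  c₁ = loopCol {k} v₁

  u : Vtx k → ℕ
  u = util P D

  B⊆D∪c₁ : ∀ {j} → j ∈ B → j ∉ D → j ≡ c₁
  B⊆D∪c₁ {j} j∈B j∉D with j ≟ c₁
  ... | yes j≡c₁ = j≡c₁
  ... | no  j≢c₁ = ⊥-elim (2+[n∸1]≰n (k + k) (begin
    suc (suc ((k + k) ∸ 1))  ≡⟨ cong (λ n → suc (suc n)) ∣B∩D∣≡n∸1 ⟨
    suc (suc ∣ B ∩ D ∣)      ≤⟨ s≤s (s≤s (p⊆q⇒∣p∣≤∣q∣ B∩D⊆B-c₁-j)) ⟩
    suc (suc ∣ B - c₁ - j ∣)  ≤⟨ s≤s (x∈p⇒∣p-x∣<∣p∣ (x∈p∧x≢y⇒x∈p-y j∈B j≢c₁)) ⟩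
    suc ∣ B - c₁ ∣            ≤⟨ x∈p⇒∣p-x∣<∣p∣ c₁∈B ⟩
    ∣ B ∣                     ≡⟨ ∣B∣≡n ⟩
    k + k                     ∎))
    where
    open ≤-Reasoning
    B∩D⊆B-c₁-j : ∀ {y} → y ∈ B ∩ D → y ∈ B - c₁ - j
    B∩D⊆B-c₁-j {y} y∈B∩D with x∈p∩q⁻ B D y∈B∩D
    ... | y∈B , y∈D = x∈p∧x≢y⇒x∈p-y (x∈p∧x≢y⇒x∈p-y y∈B (λ { refl → c₁∉D y∈D })) (λ { refl → j∉D y∈D })

  x-vanishes : ∀ {j} → j ∉ D → j ≢ c₁ → x j ≡ 0ℚ
  x-vanishes {j} j∉D j≢c₁ with j ∈? B
  ... | yes j∈B = contradiction (B⊆D∪c₁ j∈B j∉D) j≢c₁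
  ... | no  j∉B = x-supported j j∉B

  v₁-avoids-D : ∀ {j} → j ∈ D → inc P v₁ j ≡ false
  v₁-avoids-D {j} j∈D with inc P v₁ j in e
  ... | false = refl
  ... | true  = contradiction (≤-trans k<u₁ (≤-trans (util≤cost v₁ j∈D) (cost-incident≤k v₁ j e))) 1+n≰n

  covered : ∀ v → v ≢ v₁ → ∃[ j ] (j ∈ D × inc P v j ≡ true)
  covered v v≢v₁ with any? (λ j → (j ∈? D) ×-dec (inc P v j ≟ᵇ true))
  ... | yes found = found
  ... | no  none  = contradiction (trans (sym (Ax≡1 v)) (sumℚ-zero _ term≡0)) ℚ.1≢0
    where
    term≡0 : ∀ j → Amat P v j *ℚ x j ≡ 0ℚ
    term≡0 j with inc P v j in e
    ... | false = ℚ.*-zeroˡ (x j)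
    ... | true  = trans (ℚ.*-identityˡ (x j)) (x-vanishes (λ j∈D → none (j , j∈D , e)) j≢c₁)
      where
      j≢c₁ : j ≢ c₁
      j≢c₁ refl = contradiction (trans (sym e) (trans (inc-loopCol v v₁) (≟-false v≢v₁))) λ ()

  u≤k : ∀ v → v ≢ v₁ → u v ≤ k
  u≤k v v≢v₁ with covered v v≢v₁
  ... | j , j∈D , e = ≤-trans (util≤cost v j∈D) (cost-incident≤k v j e)

  edgeCol∈D⇒≢m₁ : ∀ {i r} → edgeCol {k} i r ∈ D → i ≢ m₁
  edgeCol∈D⇒≢m₁ {r = r} e∈D refl =
    contradiction (trans (sym (inc-edgeCol-own m₁ r)) (v₁-avoids-D e∈D)) λ ()

  inc-v₁-edgeCol : ∀ {i} r → i ≢ m₁ → inc P v₁ (edgeCol {k} i r) ≡ false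
  inc-v₁-edgeCol {i} r i≢m₁ = trans (inc-man-edgeCol m₁ i r) (≟-false (≢-sym i≢m₁))

  pivot : ∃[ p ] ∃[ r ] (edgeCol {k} p r ∈ D × u v₁ ≡ cost P v₁ (edgeCol {k} p r))
  pivot with util-attained v₁ j₀∈D
  ... | j , j∈D , u₁≡ with colView j
  ...   | edge p r = p , r , j∈D , u₁≡
  ...   | loop l   =
    ⊥-elim (<⇒≱ (k²<cost-nonincident-loopCol v₁ l v₁≢l) (≤-trans (≤-reflexive (sym u₁≡)) u₁≤k²))
    where
    v₁≢l : v₁ ≢ l
    v₁≢l refl = contradiction (trans (sym (inc-loopCol-own v₁)) (v₁-avoids-D j∈D)) λ ()

  p : Fin k
  p = proj₁ pivot

  r⋆ : Fin k
  r⋆ = proj₁ (proj₂ pivot)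

  j⋆ : Col k
  j⋆ = edgeCol {k} p r⋆

  j⋆∈D : j⋆ ∈ D
  j⋆∈D = proj₁ (proj₂ (proj₂ pivot))

  u₁≡cost-j⋆ : u v₁ ≡ cost P v₁ j⋆
  u₁≡cost-j⋆ = proj₂ (proj₂ (proj₂ pivot))

  p≢m₁ : p ≢ m₁
  p≢m₁ = edgeCol∈D⇒≢m₁ j⋆∈D

  j⋆-rightmost : ∀ {i r} → edgeCol {k} i r ∈ D → toℕ (edgeCol {k} i r) ≤ toℕ j⋆
  j⋆-rightmost {i} {r} e∈D = ≮⇒≥ λ j⋆<e →
    <⇒≱ (cost-nonincident-edgeCol-antitone v₁ (inc-v₁-edgeCol r⋆ p≢m₁)
           (inc-v₁-edgeCol r (edgeCol∈D⇒≢m₁ e∈D)) j⋆<e)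
        (subst (_≤ cost P v₁ (edgeCol {k} i r)) u₁≡cost-j⋆ (util≤cost v₁ e∈D))

  dominated-left-of-j⋆ : ∀ {i r} → i ≢ m₁ → toℕ (edgeCol {k} i r) < toℕ j⋆ →
    ∃[ v ] (v ≢ v₁ × Tight (edgeCol {k} i r) v)
  dominated-left-of-j⋆ {i} {r} i≢m₁ e<j⋆ with ordinal (edgeCol {k} i r)
  ... | v , c≤u with v ≟ v₁
  ...   | yes refl = ⊥-elim (<⇒≱ u₁<cost c≤u)
    where
    u₁<cost : u v₁ < cost P v₁ (edgeCol {k} i r)
    u₁<cost = subst (_< cost P v₁ (edgeCol {k} i r)) (sym u₁≡cost-j⋆)
      (cost-nonincident-edgeCol-antitone v₁ (inc-v₁-edgeCol r i≢m₁) (inc-v₁-edgeCol r⋆ p≢m₁) e<j⋆)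
  ...   | no  v≢v₁ with inc P v (edgeCol {k} i r) in e
  ...     | true  = v , v≢v₁ , e , c≤u
  ...     | false = ⊥-elim (<⇒≱ (k<cost-nonincident-edgeCol v i r e) (≤-trans c≤u (u≤k v v≢v₁)))

  man-covered : ∀ a → a ≢ m₁ → HasLoop D a ⊎ HasValid D a
  man-covered a a≢m₁ with covered (man {k} a) (a≢m₁ ∘ man-injective)
  ... | j , j∈D , e with colView j
  ...   | loop l with incident-loopCol e
  ...     | refl = inj₁ j∈D
  man-covered a a≢m₁ | j , j∈D , e | edge i r with man-incident-edgeCol e
  ...     | refl = inj₂ (r , j∈D)

  ¬valid-after-p : ∀ {i} → toℕ p < toℕ i → ¬ HasValid D i
  ¬valid-after-p p<i (r , e∈D) = <⇒≱ (edgeCol-<-man r⋆ r p<i) (j⋆-rightmost e∈D)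

  loop-after-p : ∀ {i} → i ≢ m₁ → toℕ p < toℕ i → HasLoop D i
  loop-after-p {i} i≢m₁ p<i with man-covered i i≢m₁
  ... | inj₁ loop∈D  = loop∈D
  ... | inj₂ valid = contradiction valid (¬valid-after-p p<i)

  loop-at-p : HasLoop D p
  loop-at-p with loopCol {k} (man {k} p) ∈? D
  ... | yes loop∈D = loop∈D
  ... | no  loop∉D = contradiction (subst (_< k + k) ∣D∣≡n (tight-cover⇒∣D∣<n v₁ tight-cover)) 1+n≰n
    where
    j⋆-tight : Tight j⋆ (man {k} p)
    j⋆-tight with util-attained (man {k} p) j⋆∈D
    ... | g , g∈D , u≡ with inc P (man {k} p) g in e
    ...   | false = ⊥-elim (<⇒≱ (k<cost-nonincident _ g e)
                              (subst (_≤ k) u≡ (u≤k (man {k} p) (p≢m₁ ∘ man-injective))))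
    ...   | true with colView g
    ...     | loop l with incident-loopCol e
    ...       | refl = ⊥-elim (loop∉D g∈D)
    j⋆-tight | g , g∈D , u≡ | true | edge i r with man-incident-edgeCol e
    ...       | refl = inc-edgeCol-own p r⋆ ,
      subst (cost P (man {k} p) j⋆ ≤_) (sym u≡)
        (subst₂ _≤_ (sym (cost-man-edgeCol p r⋆)) (sym (cost-man-edgeCol p r))
          (∸-monoʳ-≤ k (edgeCol-≤-rank p (j⋆-rightmost g∈D))))
    tight-cover : ∀ {j} → j ∈ D → ∃[ v ] (v ≢ v₁ × Tight j v)
    tight-cover {j} j∈D with colView j
    ... | loop l = l , (λ { refl → c₁∉D j∈D }) , inc-loopCol-own l ,
                   subst (_≤ u l) (sym (cost-loopCol-own l)) z≤n
    ... | edge i r with <-cmp (toℕ (edgeCol {k} i r)) (toℕ j⋆)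
    ...   | tri< e<j⋆ _ _ = dominated-left-of-j⋆ (edgeCol∈D⇒≢m₁ j∈D) e<j⋆
    ...   | tri> _ _ j⋆<e = ⊥-elim (<⇒≱ j⋆<e (j⋆-rightmost j∈D))
    ...   | tri≈ _ e≡j⋆ _ with edgeCol-injective (toℕ-injective e≡j⋆)
    ...     | refl , refl = man {k} p , (p≢m₁ ∘ man-injective) , j⋆-tight

  x-c₁≡1 : x c₁ ≡ 1ℚ
  x-c₁≡1 = trans (sym (sumℚ-indicator c₁ x)) (trans (sumℚ-cong term) (Ax≡1 v₁))
    where
    term : ∀ j → (if ⌊ j ≟ c₁ ⌋ then x j else 0ℚ) ≡ Amat P v₁ j *ℚ x j
    term j with j ≟ c₁
    ... | yes refl rewrite inc-loopCol-own v₁ = sym (ℚ.*-identityˡ (x c₁))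
    ... | no  j≢c₁ with inc P v₁ j in e
    ...   | false = sym (ℚ.*-zeroˡ (x j))
    ...   | true  = sym (trans (ℚ.*-identityˡ (x j))
                      (x-vanishes (λ j∈D → contradiction (trans (sym e) (v₁-avoids-D j∈D)) λ ()) j≢c₁))

  some-woman-loop : ¬ (∀ w → loopCol {k} (woman {k} w) ∉ D)
  some-woman-loop no-loop = 1ℚ≰0ℚ (begin
    1ℚ                                          ≡⟨ trans (cong₂ _*ℚ_ (sign-man m₁) x-c₁≡1) (ℚ.*-identityˡ 1ℚ) ⟨
    sign v₁ *ℚ x c₁                             ≡⟨ cong (_*ℚ x c₁) (signedColumn-loopCol v₁) ⟨
    signedColumn c₁ *ℚ x c₁                     ≤⟨ ≤-sumℚ (λ j → signedColumn j *ℚ x j) term≥0 c₁ ⟩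
    sumℚ (λ j → signedColumn j *ℚ x j)          ≡⟨ sumℚ-transpose sign (Amat P) x ⟨
    sumℚ (λ v → sign v *ℚ Ax P x v)             ≡⟨ sumℚ-cong (λ v → trans (cong (sign v *ℚ_) (Ax≡1 v))
                                                                          (ℚ.*-identityʳ (sign v))) ⟩
    sumℚ sign                                   ≡⟨ sumℚ-sign ⟩
    0ℚ                                          ∎)
    where
    open ℚ.≤-Reasoning
    term≥0 : ∀ j → 0ℚ ≤ℚ signedColumn j *ℚ x j
    term≥0 j with colView j
    ... | edge i r rewrite signedColumn-edgeCol i r | ℚ.*-zeroˡ (x (edgeCol {k} i r)) = ℚ.≤-refl
    ... | loop l with vtxView l
    ...   | isMan a rewrite signedColumn-loopCol (man {k} a) | sign-man a
                          | ℚ.*-identityˡ (x (loopCol {k} (man {k} a))) = x≥0 _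
    ...   | isWoman w rewrite x-vanishes (no-loop w) (λ eq → man≢woman m₁ w (sym (loopCol-injective eq)))
                            | ℚ.*-zeroʳ (signedColumn (loopCol {k} (woman {k} w))) = ℚ.≤-refl

  ¬loop-before-p : ∀ {i} → i ≢ m₁ → toℕ i < toℕ p → ¬ HasLoop D i
  ¬loop-before-p {i} i≢m₁ i<p loop∈D = some-woman-loop no-woman-loop
    where
    no-woman-loop : ∀ w → loopCol {k} (woman {k} w) ∉ D
    no-woman-loop w w-loop∈D with dominated-left-of-j⋆ i≢m₁ (edgeCol-<-man (men P i ⟨$⟩ˡ w) r⋆ i<p)
    ... | v , _ , inc≡true , cost≤u =
      <⇒≱ (cost-incident-edgeCol-pos v i _ inc≡true) (≤-trans cost≤u u-endpoint≤0)
      where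
      u-endpoint≤0 : u v ≤ 0
      u-endpoint≤0 with vtxView v
      ... | isMan a with man-incident-edgeCol inc≡true
      ...   | refl = util≤0 _ loop∈D
      u-endpoint≤0 | isWoman w′ with trans (woman-incident-edgeCol inc≡true) (inverseʳ (men P i))
      ...   | refl = util≤0 _ w-loop∈D

  m₁-isolated : ¬ HasLoop D m₁ × ¬ HasValid D m₁
  m₁-isolated = c₁∉D , λ (_ , e∈D) → edgeCol∈D⇒≢m₁ e∈D refl

  valid-before-p : ∀ {i} → i ≢ m₁ → toℕ i < toℕ p → HasValid D i
  valid-before-p {i} i≢m₁ i<p with man-covered i i≢m₁
  ... | inj₁ loop∈D = contradiction loop∈D (¬loop-before-p i≢m₁ i<p)
  ... | inj₂ valid  = valid

proposition2 : (k : ℕ) → 2 ≤ k → (P : Prefs k) → (D : Subset ((k + k) + k * k)) →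
    AlmostFeasible P D →
    (∀ (i₁ : Fin k) → toℕ i₁ ≡ 0 →
      suc k ≤ util {k} P D (man i₁) × util {k} P D (man i₁) ≤ k * k) →
    (Σ[ i ∈ Fin k ] (1 ≤ toℕ i × loopCol {k} (man i) ∈ D)) →
    Σ[ i ∈ Fin k ] (1 ≤ toℕ i
      × (HasLoop D i × HasValid D i)
      × (∀ (i' : Fin k) → 1 ≤ toℕ i' → toℕ i' < toℕ i → HasValid D i' × ¬ HasLoop D i')
      × (∀ (i' : Fin k) → toℕ i < toℕ i' → HasLoop D i' × ¬ HasValid D i')
      × (∀ (i₁ : Fin k) → toℕ i₁ ≡ 0 → ¬ HasLoop D i₁ × ¬ HasValid D i₁))
proposition2 k (s≤s (s≤s _)) P D
  ((∣D∣≡n , ordinal) , column1∉D , B , (∣B∣≡n , _ , x , supported , x≥0 , Ax≡1) , (c , c≡0 , c∈B) , ∣B∩D∣≡n∸1)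
  u₁-bounds (_ , _ , j₀∈D) =
  p , ≢zero⇒1≤toℕ p≢m₁ , (loop-at-p , r⋆ , j⋆∈D) ,
  (λ i 1≤i i<p → valid-before-p (1≤toℕ⇒≢zero 1≤i) i<p , ¬loop-before-p (1≤toℕ⇒≢zero 1≤i) i<p) ,
  (λ i p<i → loop-after-p (1≤toℕ⇒≢zero (≤-trans (s≤s z≤n) p<i)) p<i , ¬valid-after-p p<i) ,
  λ i₁ i₁≡0 → subst (λ i → ¬ HasLoop D i × ¬ HasValid D i) (sym (toℕ-injective i₁≡0)) m₁-isolated
  where
  -- The loop of some mᵢ (i ≥ 2) in D is only needed as a witness that D is nonempty.
  open AlmostFeasibleOrdinalBasis P D ∣D∣≡n ordinal zero (column1∉D _ refl)
    B ∣B∣≡n (subst (_∈ B) (toℕ-injective c≡0) c∈B) ∣B∩D∣≡n∸1 x supported x≥0 Ax≡1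
    (proj₁ (u₁-bounds zero refl)) (proj₂ (u₁-bounds zero refl)) j₀∈D
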